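{- Let $k\ge6$ be an even integer and set $m_F=\mathcal{F}(k)$. Then $\pi_F(m_F)=k$, and $\pi_F(m)\ne k$ for every integer $m>m_F$. Moreover, $m_F=F_{k/2}$ if $k\equiv0\pmod4$ and $m_F=L_{k/2}$ if $k\equiv2\pmod4$.
   Context: $F_n$ are the Fibonacci numbers ($F_0=0,F_1=1$) and $L_n$ the Lucas numbers ($L_0=2,L_1=1$), both satisfying $x_n=x_{n-1}+x_{n-2}$. $\mathcal{F}(k)$ is the greatest common divisor of all sums $\sum_{i=0}^{k-1}F_{n+i}$, $n\ge1$. For $m\ge2$, $\pi_F(m)$ is the Pisano period: the smallest positive $r$ with $F_r\equiv0$ and $F_{r+1}\equiv1\pmod m$. -}

module Defs where

open import Data.Nat using (ℕ; zero; suc; _+_; _*_; _<_; _≤_)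
open import Data.Nat.Divisibility using (_∣_)
open import Data.Product using (Σ; _×_; ∃)
open import Relation.Binary.PropositionalEquality using (_≡_)
open import Relation.Nullary using (¬_)

fib : ℕ → ℕ
fib 0 = 0
fib 1 = 1
fib (suc (suc n)) = fib (suc n) + fib n

lucas : ℕ → ℕ
lucas 0 = 2
lucas 1 = 1
lucas (suc (suc n)) = lucas (suc n) + lucas n

sumFib : ℕ → ℕ → ℕ
sumFib zero n = 0
sumFib (suc k) n = fib (n + k) + sumFib k n

IsGcdOfSums : ℕ → ℕ → Set
IsGcdOfSums k d =
  (∀ n → 1 ≤ n → d ∣ sumFib k n) ×
  (∀ c → (∀ n → 1 ≤ n → c ∣ sumFib k n) → c ∣ d)

-- F_r ≡ 0 and F_{r+1} ≡ 1 (mod m)   (for m ≥ 2)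
PisanoCond : ℕ → ℕ → Set
PisanoCond m r = (m ∣ fib r) × (∃ λ q → fib (suc r) ≡ q * m + 1)

IsPisanoPeriod : ℕ → ℕ → Set
IsPisanoPeriod m r =
  (0 < r) × PisanoCond m r × (∀ s → 0 < s → s < r → ¬ PisanoCond m s)

{-# OPTIONS --safe #-}

-- Write k = 2j. The doubling formulas F(2j) = F(j) L(j) and F(2j+1) = F(j+1)² + F(j)², with Cassini's
-- identity, give F(2j) = m X(j) and F(2j+1) = 1 + m X(j+1), where (m, X) = (F(j), L) for j even and
-- (L(j), F) for j odd. Hence F(n+2j) = F(n) + m X(n+j) for all n, so the n-th sum, F(n+1+2j) − F(n+1),
-- is m X(n+1+j), and running the recursion of X backwards down to X(1) = 1 shows that m is the gcd.
-- A modulus with Pisano period k divides every sum, hence divides m. The period of m is exactly k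
-- because F(s) < m for 0 < s < j and F(j+1) ≢ 1 (mod m).
module Submission where

open import Defs
open import Data.Nat using (ℕ; zero; suc; _+_; _*_; _≤_; _<_; _≤′_; ≤′-refl; ≤′-step; _/_; _%_; z≤n; s≤s; >-nonZero)
open import Data.Nat.Properties
open import Data.Nat.Divisibility using (_∣_; divides; ∣m+n∣m⇒∣n; ∣⇒≤; >⇒∤; m∣m*n)
open import Data.Nat.DivMod using ([m+kn]%n≡m%n; m*n%n≡0; m*n/n≡m; m<n⇒m%n≡m)
open import Data.Nat.Tactic.RingSolver using (solve-∀)
open import Data.Product using (_×_; ∃; _,_)
open import Data.Sum using (_⊎_; inj₁; inj₂)
open import Relation.Binary using (tri<; tri≈; tri>)
open import Relation.Binary.PropositionalEquality using (_≡_; _≢_; refl; sym; trans; cong; cong₂; subst; module ≡-Reasoning)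
open import Relation.Nullary using (¬_; contradiction)
open import Function using (_∘_)

open ≡-Reasoning

FibLike : (ℕ → ℕ) → Set
FibLike X = ∀ n → X (suc (suc n)) ≡ X (suc n) + X n

fibLike-*ˡ : ∀ m {X} → FibLike X → FibLike (λ n → m * X n)
fibLike-*ˡ m X-rec n = trans (cong (m *_) (X-rec n)) (*-distribˡ-+ m _ _)

fib-+ : ∀ m n → fib (suc (m + n)) ≡ fib (suc m) * fib (suc n) + fib m * fib n
fib-+ zero n = base (fib (suc n)) (fib n)
  where
  base : ∀ x y → x ≡ 1 * x + 0 * y
  base = solve-∀
fib-+ (suc zero) n = base (fib (suc n)) (fib n)
  where
  base : ∀ x y → x + y ≡ 1 * x + 1 * y
  base = solve-∀
fib-+ (suc (suc m)) n = trans (cong₂ _+_ (fib-+ (suc m) n) (fib-+ m n))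
  (regroup (fib (suc (suc m))) (fib (suc m)) (fib m) (fib (suc n)) (fib n))
  where
  regroup : ∀ a b c u v → (a * u + b * v) + (b * u + c * v) ≡ (a + b) * u + (b + c) * v
  regroup = solve-∀

lucas≡fib+fib : ∀ n → lucas (suc n) ≡ fib n + fib (suc (suc n))
lucas≡fib+fib zero = refl
lucas≡fib+fib (suc zero) = refl
lucas≡fib+fib (suc (suc n)) = trans (cong₂ _+_ (lucas≡fib+fib (suc n)) (lucas≡fib+fib n))
  (regroup (fib (suc n)) (fib n) (fib (suc (suc (suc n)))) (fib (suc (suc n))))
  where
  regroup : ∀ a b c d → (a + c) + (b + d) ≡ (a + b) + (c + d)
  regroup = solve-∀

fib-double : ∀ n → fib (n + n) ≡ fib n * lucas n
fib-double zero = refl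
fib-double (suc n) = begin
  fib (suc (n + suc n))                                    ≡⟨ fib-+ n (suc n) ⟩
  fib (suc n) * fib (suc (suc n)) + fib n * fib (suc n)    ≡⟨ factor (fib (suc n)) (fib (suc (suc n))) (fib n) ⟩
  fib (suc n) * (fib n + fib (suc (suc n)))                ≡⟨ cong (fib (suc n) *_) (lucas≡fib+fib n) ⟨
  fib (suc n) * lucas (suc n)                              ∎
  where
  factor : ∀ a b c → a * b + c * a ≡ a * (c + b)
  factor = solve-∀

-- Over ℕ Cassini's identity F(n+1)² − F(n) F(n+2) = (−1)ⁿ splits by parity; only even n is needed.
cassini-even : ∀ i → fib (suc (i * 2)) * fib (suc (i * 2)) ≡ 1 + fib (i * 2) * fib (suc (suc (i * 2)))
cassini-even zero = refl
cassini-even (suc i) = step (fib (suc (i * 2))) (fib (i * 2)) (cassini-even i)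
  where
  step : ∀ x w → x * x ≡ 1 + w * (x + w) →
    (x + w + x) * (x + w + x) ≡ 1 + (x + w) * (x + w + x + (x + w))
  step x w h = begin
    (x + w + x) * (x + w + x)                   ≡⟨ expand x w ⟩
    x * x + r                                   ≡⟨ cong (_+ r) h ⟩
    1 + w * (x + w) + r                         ≡⟨ collect x w ⟩
    1 + (x + w) * (x + w + x + (x + w))         ∎
    where
    r = 3 * x * x + 4 * x * w + w * w
    expand : ∀ x w → (x + w + x) * (x + w + x) ≡ x * x + (3 * x * x + 4 * x * w + w * w)
    expand = solve-∀
    collect : ∀ x w →
      1 + w * (x + w) + (3 * x * x + 4 * x * w + w * w) ≡ 1 + (x + w) * (x + w + x + (x + w))
    collect = solve-∀

fib-double-suc-even : ∀ i → let j = i * 2 in fib (suc (j + j)) ≡ 1 + fib j * lucas (suc j)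
fib-double-suc-even i = begin
  fib (suc (j + j))                              ≡⟨ fib-+ j j ⟩
  fib (suc j) * fib (suc j) + fib j * fib j      ≡⟨ cong (_+ fib j * fib j) (cassini-even i) ⟩
  1 + fib j * fib (suc (suc j)) + fib j * fib j  ≡⟨ factor (fib j) (fib (suc (suc j))) ⟩
  1 + fib j * (fib j + fib (suc (suc j)))        ≡⟨ cong (λ l → 1 + fib j * l) (lucas≡fib+fib j) ⟨
  1 + fib j * lucas (suc j)                      ∎
  where
  j = i * 2
  factor : ∀ a c → 1 + a * c + a * a ≡ 1 + a * (a + c)
  factor = solve-∀

fib-double-suc-odd : ∀ i → let j = suc (i * 2) in fib (suc (j + j)) ≡ 1 + lucas j * fib (suc j)
fib-double-suc-odd i = begin
  fib (suc (j + j))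
    ≡⟨ fib-+ j j ⟩
  fib (suc j) * fib (suc j) + fib j * fib j
    ≡⟨ cong (fib (suc j) * fib (suc j) +_) (cassini-even i) ⟩
  fib (suc j) * fib (suc j) + (1 + fib (i * 2) * fib (suc j))
    ≡⟨ factor (fib (suc j)) (fib (i * 2)) ⟩
  1 + (fib (i * 2) + fib (suc j)) * fib (suc j)
    ≡⟨ cong (λ l → 1 + l * fib (suc j)) (lucas≡fib+fib (i * 2)) ⟨
  1 + lucas j * fib (suc j)
    ∎
  where
  j = suc (i * 2)
  factor : ∀ b c → b * b + (1 + c * b) ≡ 1 + (c + b) * b
  factor = solve-∀

fib-pos : ∀ n → 0 < fib (suc n)
fib-pos zero = s≤s z≤n
fib-pos (suc zero) = s≤s z≤n
fib-pos (suc (suc n)) = ≤-trans (fib-pos (suc n)) (m≤m+n _ _)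

fib-≤-suc : ∀ n → fib n ≤ fib (suc n)
fib-≤-suc zero = z≤n
fib-≤-suc (suc n) = m≤m+n _ _

fib-<-suc : ∀ n → fib (suc (suc n)) < fib (suc (suc (suc n)))
fib-<-suc n = m<m+n (fib (suc (suc n))) (fib-pos n)

fib-mono-≤ : ∀ {m n} → m ≤ n → fib m ≤ fib n
fib-mono-≤ m≤n = mono (≤⇒≤′ m≤n)
  where
  mono : ∀ {m n} → m ≤′ n → fib m ≤ fib n
  mono ≤′-refl = ≤-refl
  mono {n = suc n} (≤′-step m≤′n) = ≤-trans (mono m≤′n) (fib-≤-suc n)

fib-<-lucas : ∀ {s} n → s ≤ suc (suc n) → fib s < lucas (suc (suc n))
fib-<-lucas {s} n s≤n+2 = subst (fib s <_) (sym (lucas≡fib+fib (suc n)))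
  (≤-<-trans (fib-mono-≤ (≤-trans s≤n+2 (n≤1+n _))) (m<n+m (fib (suc (suc (suc n)))) (fib-pos n)))

m+r≢q*m+1 : ∀ {m r} q → 1 < r → r < m → m + r ≢ q * m + 1
m+r≢q*m+1 {m@(suc _)} {r} q 1<r r<m eq = >⇒≢ 1<r (begin
  r                   ≡⟨ m<n⇒m%n≡m r<m ⟨
  r % m               ≡⟨ [m+kn]%n≡m%n r 1 m ⟨
  (r + 1 * m) % m     ≡⟨ cong (_% m) (trans (+-comm r _) (cong (_+ r) (*-identityˡ m))) ⟩
  (m + r) % m         ≡⟨ cong (_% m) (trans eq (+-comm _ 1)) ⟩
  (1 + q * m) % m     ≡⟨ [m+kn]%n≡m%n 1 q m ⟩
  1 % m               ≡⟨ m<n⇒m%n≡m (<-trans 1<r r<m) ⟩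
  1                   ∎)

sumFib+fib≡fib : ∀ k n → sumFib k n + fib (suc n) ≡ fib (suc n + k)
sumFib+fib≡fib zero n = cong fib (sym (+-identityʳ (suc n)))
sumFib+fib≡fib (suc k) n = begin
  fib (n + k) + sumFib k n + fib (suc n)   ≡⟨ +-assoc (fib (n + k)) (sumFib k n) (fib (suc n)) ⟩
  fib (n + k) + (sumFib k n + fib (suc n)) ≡⟨ cong (fib (n + k) +_) (sumFib+fib≡fib k n) ⟩
  fib (n + k) + fib (suc (n + k))          ≡⟨ +-comm (fib (n + k)) (fib (suc (n + k))) ⟩
  fib (suc (suc (n + k)))                  ≡⟨ cong (fib ∘ suc) (+-suc n k) ⟨
  fib (suc n + suc k)                      ∎

sumFib≡ : ∀ {k n c} → fib (suc n + k) ≡ fib (suc n) + c → sumFib k n ≡ c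
sumFib≡ {k} {n} {c} eq = +-cancelʳ-≡ (fib (suc n)) _ _
  (trans (sumFib+fib≡fib k n) (trans eq (+-comm (fib (suc n)) c)))

fibLike-shift : ∀ {X k j m} → FibLike X → fib k ≡ m * X j → fib (suc k) ≡ 1 + m * X (suc j) →
  ∀ n → fib (n + k) ≡ fib n + m * X (n + j)
fibLike-shift {X} {k} {j} {m} X-rec base₀ base₁ = shift
  where
  regroup : ∀ a c b d m → (a + m * b) + (c + m * d) ≡ (a + c) + m * (b + d)
  regroup = solve-∀
  shift : ∀ n → fib (n + k) ≡ fib n + m * X (n + j)
  shift zero = base₀
  shift (suc zero) = base₁
  shift (suc (suc n)) = begin
    fib (suc (n + k)) + fib (n + k)
      ≡⟨ cong₂ _+_ (shift (suc n)) (shift n) ⟩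
    (fib (suc n) + m * X (suc (n + j))) + (fib n + m * X (n + j))
      ≡⟨ regroup (fib (suc n)) (fib n) (X (suc (n + j))) (X (n + j)) m ⟩
    fib (suc (suc n)) + m * (X (suc (n + j)) + X (n + j))
      ≡⟨ cong (λ x → fib (suc (suc n)) + m * x) (X-rec (n + j)) ⟨
    fib (suc (suc n)) + m * X (suc (suc (n + j)))
      ∎

pisanoCond-shift : ∀ {m s} → PisanoCond m s → ∀ n → ∃ λ c → fib (n + s) ≡ fib n + m * c
pisanoCond-shift {m} (divides a fs≡a*m , _) zero = a , trans fs≡a*m (*-comm a m)
pisanoCond-shift {m} {s} (divides a fs≡a*m , q , fs+1≡q*m+1) (suc n) =
  fib (suc n) * q + fib n * a , (begin
    fib (suc (n + s))
      ≡⟨ fib-+ n s ⟩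
    fib (suc n) * fib (suc s) + fib n * fib s
      ≡⟨ cong₂ (λ u v → fib (suc n) * u + fib n * v) fs+1≡q*m+1 fs≡a*m ⟩
    fib (suc n) * (q * m + 1) + fib n * (a * m)
      ≡⟨ regroup (fib (suc n)) (fib n) q m a ⟩
    fib (suc n) + m * (fib (suc n) * q + fib n * a)
      ∎)
  where
  regroup : ∀ x y q m a → x * (q * m + 1) + y * (a * m) ≡ x + m * (x * q + y * a)
  regroup = solve-∀

pisanoCond⇒∣sumFib : ∀ {m k} → PisanoCond m k → ∀ n → m ∣ sumFib k n
pisanoCond⇒∣sumFib {m} {k} p n with pisanoCond-shift {m} {k} p (suc n)
... | c , eq = subst (m ∣_) (sym (sumFib≡ {k} {n} eq)) (m∣m*n c)

∣-fibLike-descent : ∀ {Y c} → FibLike Y → ∀ d → c ∣ Y (suc d) → c ∣ Y (suc (suc d)) → c ∣ Y 1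
∣-fibLike-descent Y-rec zero c∣Y₁ _ = c∣Y₁
∣-fibLike-descent {Y} Y-rec (suc d) c∣Yd+1 c∣Yd+2 =
  ∣-fibLike-descent {Y} Y-rec d (∣m+n∣m⇒∣n (subst (_ ∣_) (Y-rec (suc d)) c∣Yd+2) c∣Yd+1) c∣Yd+1

isGcdOfSums : ∀ {X k j m} → FibLike X → X 1 ≡ 1 →
  (∀ n → fib (n + k) ≡ fib n + m * X (n + j)) → IsGcdOfSums k m
isGcdOfSums {X} {k} {j} {m} X-rec X₁≡1 shift = (λ n _ → subst (m ∣_) (sym (sum≡ n)) (m∣m*n _)) , greatest
  where
  sum≡ : ∀ n → sumFib k n ≡ m * X (suc n + j)
  sum≡ n = sumFib≡ {k} {n} (shift (suc n))
  greatest : ∀ c → (∀ n → 1 ≤ n → c ∣ sumFib k n) → c ∣ m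
  greatest c c∣sums = subst (c ∣_) (trans (cong (m *_) X₁≡1) (*-identityʳ m))
    (∣-fibLike-descent {λ n → m * X n} (fibLike-*ˡ m X-rec) (suc j)
      (subst (c ∣_) (sum≡ 1) (c∣sums 1 (s≤s z≤n)))
      (subst (c ∣_) (sum≡ 2) (c∣sums 2 (s≤s z≤n))))

fib<m⇒m∤fib : ∀ {m} s → 0 < s → fib s < m → ¬ m ∣ fib s
fib<m⇒m∤fib (suc s) _ = >⇒∤ {{>-nonZero (fib-pos s)}}

¬pisanoCond-below : ∀ {j m} → m ∣ fib (j + j) →
  (∀ s → 0 < s → s < j → fib s < m) → ¬ PisanoCond m j →
  ∀ s → 0 < s → s < j + j → ¬ PisanoCond m s
¬pisanoCond-below {j} {m} m∣F2j small ¬Pj s 0<s s<2j p@(m∣Fs , _) with <-cmp s j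
... | tri< s<j _ _ = fib<m⇒m∤fib s 0<s (small s 0<s s<j) m∣Fs
... | tri≈ _ refl _ = ¬Pj p
... | tri> _ _ j<s with m≤n⇒∃[o]m+o≡n s<2j
... | o , s+1+o≡2j = fib<m⇒m∤fib (suc o) (s≤s z≤n) (small (suc o) (s≤s z≤n) o+1<j) m∣Fo+1
  where
  -- A Pisano condition at s shifts indices by s modulo m, so F(2j − s) ≡ F(2j) ≡ 0 with 0 < 2j − s < j.
  o+1+s≡2j : suc o + s ≡ j + j
  o+1+s≡2j = trans (+-comm (suc o) s) (trans (+-suc s o) s+1+o≡2j)
  o+1<j : suc o < j
  o+1<j = +-cancelʳ-< j (suc o) j (subst (suc o + j <_) o+1+s≡2j (+-monoʳ-< (suc o) j<s))
  m∣Fo+1 : m ∣ fib (suc o)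
  m∣Fo+1 with pisanoCond-shift p (suc o)
  ... | c , eq = ∣m+n∣m⇒∣n (subst (m ∣_) F2j≡ m∣F2j) (m∣m*n c)
    where
    F2j≡ : fib (j + j) ≡ m * c + fib (suc o)
    F2j≡ = trans (cong fib (sym o+1+s≡2j)) (trans eq (+-comm (fib (suc o)) (m * c)))

pisanoPeriod⇒≤gcdOfSums : ∀ {k m m′} → IsGcdOfSums k m → 0 < m → IsPisanoPeriod m′ k → m′ ≤ m
pisanoPeriod⇒≤gcdOfSums {k} {m′ = m′} (_ , greatest) 0<m (_ , p , _) =
  ∣⇒≤ {{>-nonZero 0<m}} (greatest m′ (λ n _ → pisanoCond⇒∣sumFib {m′} {k} p n))

IsLargestModulusWithPeriod : ℕ → ℕ → Set
IsLargestModulusWithPeriod k m = IsPisanoPeriod m k × (∀ m′ → m < m′ → ¬ IsPisanoPeriod m′ k)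

gcdOfSums-isLargestModulusWithPeriod : ∀ {X k j m} → k ≡ j + j → 1 ≤ j → 0 < m → FibLike X → X 1 ≡ 1 →
  fib (j + j) ≡ m * X j → fib (suc (j + j)) ≡ 1 + m * X (suc j) →
  (∀ s → 0 < s → s < j → fib s < m) → ¬ PisanoCond m j →
  IsGcdOfSums k m × IsLargestModulusWithPeriod k m
gcdOfSums-isLargestModulusWithPeriod {X} {_} {j} {m} refl 1≤j 0<m X-rec X₁≡1 base₀ base₁ small ¬Pj =
  gcd , (≤-trans 1≤j (m≤m+n j j) , P2j , ¬pisanoCond-below m∣F2j small ¬Pj) , maximal
  where
  gcd : IsGcdOfSums (j + j) m
  gcd = isGcdOfSums {X} {j + j} {j} X-rec X₁≡1 (fibLike-shift {X} {j + j} {j} {m} X-rec base₀ base₁)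
  m∣F2j : m ∣ fib (j + j)
  m∣F2j = divides (X j) (trans base₀ (*-comm m (X j)))
  P2j : PisanoCond m (j + j)
  P2j = m∣F2j , X (suc j) , trans base₁ (trans (+-comm 1 _) (cong (_+ 1) (*-comm m _)))
  maximal : ∀ m′ → m < m′ → ¬ IsPisanoPeriod m′ (j + j)
  maximal m′ m<m′ period = <⇒≱ m<m′ (pisanoPeriod⇒≤gcdOfSums gcd 0<m period)

fib-isGcdOfSums-isLargest : ∀ {k} i → let j = 4 + i * 2 in
  k ≡ j + j → IsGcdOfSums k (fib j) × IsLargestModulusWithPeriod k (fib j)
fib-isGcdOfSums-isLargest i k≡j+j =
  gcdOfSums-isLargestModulusWithPeriod {lucas} k≡j+j (s≤s z≤n) (fib-pos (3 + i * 2)) (λ _ → refl) refl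
    (fib-double j) (fib-double-suc-even (2 + i)) small ¬Pj
  where
  j = 4 + i * 2
  small : ∀ s → 0 < s → s < j → fib s < fib j
  small s _ s<j = ≤-<-trans (fib-mono-≤ (≤-pred s<j)) (fib-<-suc (1 + i * 2))
  -- F(j+1) = F(j) + F(j−1) with 1 < F(j−1) < F(j), so F(j+1) ≢ 1 (mod F(j)).
  ¬Pj : ¬ PisanoCond (fib j) j
  ¬Pj (_ , q , eq) = m+r≢q*m+1 q (fib-mono-≤ {3} {3 + i * 2} (s≤s (s≤s (s≤s z≤n)))) (fib-<-suc (1 + i * 2)) eq

lucas-isGcdOfSums-isLargest : ∀ {k} i → let j = 3 + i * 2 in
  k ≡ j + j → IsGcdOfSums k (lucas j) × IsLargestModulusWithPeriod k (lucas j)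
lucas-isGcdOfSums-isLargest i k≡j+j =
  gcdOfSums-isLargestModulusWithPeriod {fib} k≡j+j (s≤s z≤n) (fib-<-lucas (1 + i * 2) z≤n) (λ _ → refl) refl
    (trans (fib-double j) (*-comm (fib j) (lucas j))) (fib-double-suc-odd (1 + i)) small ¬Pj
  where
  j = 3 + i * 2
  small : ∀ s → 0 < s → s < j → fib s < lucas j
  small s _ s<j = fib-<-lucas (1 + i * 2) (<⇒≤ s<j)
  ¬Pj : ¬ PisanoCond (lucas j) j
  ¬Pj (L∣F , _) = fib<m⇒m∤fib j (s≤s z≤n) (fib-<-lucas (1 + i * 2) ≤-refl) L∣F

even⇒mod4 : ∀ k → k % 2 ≡ 0 → ∃ λ i → k ≡ i * 4 ⊎ k ≡ 2 + i * 4
even⇒mod4 0 _ = 0 , inj₁ refl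
even⇒mod4 2 _ = 0 , inj₂ refl
even⇒mod4 (suc (suc (suc (suc k)))) k%2≡0 with even⇒mod4 k k%2≡0
... | i , inj₁ k≡4i = suc i , inj₁ (cong (4 +_) k≡4i)
... | i , inj₂ k≡2+4i = suc i , inj₂ (cong (4 +_) k≡2+4i)

4i-halves : ∀ i → let j = i * 2 in i * 4 ≡ j + j × i * 4 / 2 ≡ j × i * 4 % 4 ≡ 0
4i-halves i = rearrange i , trans (cong (_/ 2) (sym (*-assoc i 2 2))) (m*n/n≡m (i * 2) 2) , m*n%n≡0 i 4
  where
  rearrange : ∀ i → i * 4 ≡ i * 2 + i * 2
  rearrange = solve-∀

4i+2-halves : ∀ i → let j = 1 + i * 2 in 2 + i * 4 ≡ j + j × (2 + i * 4) / 2 ≡ j × (2 + i * 4) % 4 ≡ 2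
4i+2-halves i = rearrange i
  , trans (cong (λ n → (2 + n) / 2) (sym (*-assoc i 2 2))) (m*n/n≡m (1 + i * 2) 2)
  , [m+kn]%n≡m%n 2 i 4
  where
  rearrange : ∀ i → 2 + i * 4 ≡ (1 + i * 2) + (1 + i * 2)
  rearrange = solve-∀

theorem6p9 : (k : ℕ) → 6 ≤ k → k % 2 ≡ 0 →
    ∃ λ mF → IsGcdOfSums k mF
      × IsPisanoPeriod mF k
      × (∀ m → mF < m → ¬ IsPisanoPeriod m k)
      × (k % 4 ≡ 0 → mF ≡ fib (k / 2))
      × (k % 4 ≡ 2 → mF ≡ lucas (k / 2))
theorem6p9 k 6≤k k%2≡0 with even⇒mod4 k k%2≡0 | 6≤k
... | zero , inj₁ refl | ()
... | 1 , inj₁ refl | s≤s (s≤s (s≤s (s≤s ())))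
... | suc (suc i) , inj₁ refl | _ =
  let k≡j+j , k/2≡j , k%4≡0 = 4i-halves (2 + i)
      gcd , period , largest = fib-isGcdOfSums-isLargest i k≡j+j
  in  _ , gcd , period , largest
        , (λ _ → cong fib (sym k/2≡j))
        , (λ k%4≡2 → contradiction (trans (sym k%4≡0) k%4≡2) λ ())
... | zero , inj₂ refl | s≤s (s≤s ())
... | suc i , inj₂ refl | _ =
  let k≡j+j , k/2≡j , k%4≡2 = 4i+2-halves (1 + i)
      gcd , period , largest = lucas-isGcdOfSums-isLargest i k≡j+j
  in  _ , gcd , period , largest
        , (λ k%4≡0 → contradiction (trans (sym k%4≡0) k%4≡2) λ ())
        , (λ _ → cong lucas (sym k/2≡j))
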